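{- If a process $P$ reduces to a process $Q$ by the tick-last strategy, then $Q$ is in normal form for $\rightarrow$ and $Q\Rightarrow Q$. Moreover, $\lfloor P\rfloor\rightarrow^*\lfloor Q\rfloor$ and $\lfloor Q\rfloor$ is in normal form for $\rightarrow$.
   Context: Processes. Base variables $x,y,z,\dots$ and channel names $a,b,c,\dots$; $v$ ranges over both. Expressions: $e ::= v \mid \mathtt{0} \mid \mathtt{s}(e) \mid [\,] \mid e::e' \mid \mathtt{tt} \mid \mathtt{ff}$. Processes: $P,Q ::= 0 \mid P\mid Q \mid\ !a(\vec v).P \mid a(\vec v).P \mid \overline{a}\langle \vec e\rangle \mid (\nu a)P \mid \mathtt{match}\ e\ \{\mathtt{0}\mapsto P;\ \mathtt{s}(x)\mapsto Q\} \mid \mathtt{match}\ e\ \{[\,]\mapsto P;\ x::y\mapsto Q\} \mid \mathtt{if}\ e\ \mathtt{then}\ P\ \mathtt{else}\ Q \mid \mathtt{tick}.P$, up to $\alpha$-renaming; pre-processes are processes without $\mathtt{tick}$. Structural congruence $\equiv$: least congruence (closed under all constructors including $\mathtt{tick}$) with $P\mid0\equiv P$, $P\mid Q\equiv Q\mid P$, $P\mid(Q\mid R)\equiv(P\mid Q)\mid R$, $(\nu a)(\nu b)P\equiv(\nu b)(\nu a)P$, $(\nu a)(P\mid Q)\equiv(\nu a)P\mid Q$ if $a$ not free in $Q$. Reduction $\rightarrow$ (same rules on processes and pre-processes): $!a(\vec v).P\mid\overline a\langle\vec e\rangle\rightarrow\ !a(\vec v).P\mid P[\vec v:=\vec e]$;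 $a(\vec v).P\mid\overline a\langle\vec e\rangle\rightarrow P[\vec v:=\vec e]$; $\mathtt{match}\ \mathtt0\ \{\mathtt0\mapsto P;\mathtt s(x)\mapsto Q\}\rightarrow P$; $\mathtt{match}\ \mathtt s(e)\ \{\dots\}\rightarrow Q[x:=e]$; $\mathtt{match}\ [\,]\ \{[\,]\mapsto P;x::y\mapsto Q\}\rightarrow P$; $\mathtt{match}\ e::e'\ \{\dots\}\rightarrow Q[x,y:=e,e']$; $\mathtt{if}\ \mathtt{tt}\ \mathtt{then}\ P\ \mathtt{else}\ Q\rightarrow P$; $\mathtt{if}\ \mathtt{ff}\ \mathtt{then}\ P\ \mathtt{else}\ Q\rightarrow Q$; if $P\rightarrow Q$ then $P\mid R\rightarrow Q\mid R$ and $(\nu a)P\rightarrow(\nu a)Q$; if $P\equiv P'\rightarrow Q'\equiv Q$ then $P\rightarrow Q$. (Substitutions must replace names by names; no rule for $\mathtt{tick}.P$.) Time reduction $\Rightarrow$: $0\Rightarrow0$; any replicated input, input, output, $\mathtt{match}$ or $\mathtt{if}$ process reduces to itself; $\mathtt{tick}.P\Rightarrow P$; if $P\Rightarrow P'$ and $Q\Rightarrow Q'$ then $P\mid Q\Rightarrow P'\mid Q'$; if $P\Rightarrow P'$ then $(\nu a)P\Rightarrow(\nu a)P'$. Tick-last strategy: from $P$, reduce $P\rightarrow^*P'$ with $P'$ in normal form for $\rightarrow$; if $P'\Rightarrow P'$, stop with result $P'$; otherwise $P'\Rightarrow R$ with $R\ne P'$ and restart from $R$. "$P$ reduces to $Q$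 by the tick-last strategy" means a finite such run from $P$ stops with result $Q$. Tick erasure $\lfloor P\rfloor$: the pre-process obtained from $P$ by deleting every $\mathtt{tick}$ prefix, i.e. $\lfloor\mathtt{tick}.P\rfloor=\lfloor P\rfloor$ and $\lfloor\cdot\rfloor$ commutes with all other constructors (outputs unchanged). -}

module Defs where

-- Well-scoped de Bruijn syntax: terms are identified up to α-renaming
-- by construction.  Base variables and channel names share one sort of
-- variables (Fin n), as in the paper where v ranges over both.

open import Data.Nat using (ℕ; zero; suc; _+_)
open import Data.Fin using (Fin; zero; suc; splitAt; _↑ˡ_; _↑ʳ_)
open import Data.Vec using (Vec; lookup) renaming (map to vmap)
open import Data.Maybe using (Maybe; just; nothing; _>>=_)
open import Data.Sum using (inj₁; inj₂)
open import Data.Product using (∃; _×_)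
open import Relation.Nullary using (¬_)
open import Relation.Binary.PropositionalEquality using (_≡_; _≢_)
open import Relation.Binary.Construct.Closure.ReflexiveTransitive using (Star)

data Exp (n : ℕ) : Set where
  var   : Fin n → Exp n
  ezero : Exp n
  esuc  : Exp n → Exp n
  enil  : Exp n
  econs : Exp n → Exp n → Exp n
  ett   : Exp n
  eff   : Exp n

data Proc (n : ℕ) : Set where
  nil    : Proc n
  par    : Proc n → Proc n → Proc n
  -- !a(v1..vk).P : the k bound variables are the first k indices of the body
  rep    : Fin n → (k : ℕ) → Proc (k + n) → Proc n
  inp    : Fin n → (k : ℕ) → Proc (k + n) → Proc n
  out    : Fin n → {k : ℕ} → Vec (Exp n) k → Proc n
  nu     : Proc (suc n) → Proc n
  matchN : Exp n → Proc n → Proc (suc n) → Proc n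
  -- match e {[] ↦ P; x::y ↦ Q}, x (index 0), y (index 1) bound in Q
  matchL : Exp n → Proc n → Proc (suc (suc n)) → Proc n
  ite    : Exp n → Proc n → Proc n → Proc n
  tick   : Proc n → Proc n

liftʳ : ∀ {n m} k → (Fin n → Fin m) → Fin (k + n) → Fin (k + m)
liftʳ {m = m} k ρ i with splitAt k i
... | inj₁ j = j ↑ˡ m
... | inj₂ j = k ↑ʳ ρ j

renE : ∀ {n m} → (Fin n → Fin m) → Exp n → Exp m
renE ρ (var x) = var (ρ x)
renE ρ ezero = ezero
renE ρ (esuc e) = esuc (renE ρ e)
renE ρ enil = enil
renE ρ (econs e e') = econs (renE ρ e) (renE ρ e')
renE ρ ett = ett
renE ρ eff = eff

renP : ∀ {n m} → (Fin n → Fin m) → Proc n → Proc m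
renP ρ nil = nil
renP ρ (par P Q) = par (renP ρ P) (renP ρ Q)
renP ρ (rep a k P) = rep (ρ a) k (renP (liftʳ k ρ) P)
renP ρ (inp a k P) = inp (ρ a) k (renP (liftʳ k ρ) P)
renP ρ (out a es) = out (ρ a) (vmap (renE ρ) es)
renP ρ (nu P) = nu (renP (liftʳ 1 ρ) P)
renP ρ (matchN e P Q) = matchN (renE ρ e) (renP ρ P) (renP (liftʳ 1 ρ) Q)
renP ρ (matchL e P Q) = matchL (renE ρ e) (renP ρ P) (renP (liftʳ 2 ρ) Q)
renP ρ (ite e P Q) = ite (renE ρ e) (renP ρ P) (renP ρ Q)
renP ρ (tick P) = tick (renP ρ P)

wk : ∀ {n} → Proc n → Proc (suc n)
wk = renP suc

swap : ∀ {n} → Fin (suc (suc n)) → Fin (suc (suc n))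
swap zero = suc zero
swap (suc zero) = zero
swap (suc (suc i)) = suc (suc i)

-- Substitutions must replace names by names: substituting a non-name
-- expression for a variable occurring in channel position is undefined
-- (yields nothing).

liftˢ : ∀ {n m} k → (Fin n → Exp m) → Fin (k + n) → Exp (k + m)
liftˢ {m = m} k σ i with splitAt k i
... | inj₁ j = var (j ↑ˡ m)
... | inj₂ j = renE (k ↑ʳ_) (σ j)

subE : ∀ {n m} → (Fin n → Exp m) → Exp n → Exp m
subE σ (var x) = σ x
subE σ ezero = ezero
subE σ (esuc e) = esuc (subE σ e)
subE σ enil = enil
subE σ (econs e e') = econs (subE σ e) (subE σ e')
subE σ ett = ett
subE σ eff = eff

asName : ∀ {m} → Exp m → Maybe (Fin m)
asName (var x) = just x
asName _ = nothing

subP : ∀ {n m} → (Fin n → Exp m) → Proc n → Maybe (Proc m)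
subP σ nil = just nil
subP σ (par P Q) = subP σ P >>= λ P' → subP σ Q >>= λ Q' → just (par P' Q')
subP σ (rep a k P) = asName (σ a) >>= λ b → subP (liftˢ k σ) P >>= λ P' → just (rep b k P')
subP σ (inp a k P) = asName (σ a) >>= λ b → subP (liftˢ k σ) P >>= λ P' → just (inp b k P')
subP σ (out a es) = asName (σ a) >>= λ b → just (out b (vmap (subE σ) es))
subP σ (nu P) = subP (liftˢ 1 σ) P >>= λ P' → just (nu P')
subP σ (matchN e P Q) = subP σ P >>= λ P' → subP (liftˢ 1 σ) Q >>= λ Q' → just (matchN (subE σ e) P' Q')
subP σ (matchL e P Q) = subP σ P >>= λ P' → subP (liftˢ 2 σ) Q >>= λ Q' → just (matchL (subE σ e) P' Q')
subP σ (ite e P Q) = subP σ P >>= λ P' → subP σ Q >>= λ Q' → just (ite (subE σ e) P' Q')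
subP σ (tick P) = subP σ P >>= λ P' → just (tick P')

inst : ∀ {n k} → Vec (Exp n) k → Fin (k + n) → Exp n
inst {k = k} es i with splitAt k i
... | inj₁ j = lookup es j
... | inj₂ j = var j

inst1 : ∀ {n} → Exp n → Fin (suc n) → Exp n
inst1 e zero = e
inst1 e (suc i) = var i

inst2 : ∀ {n} → Exp n → Exp n → Fin (suc (suc n)) → Exp n
inst2 e e' zero = e
inst2 e e' (suc zero) = e'
inst2 e e' (suc (suc i)) = var i

infix 4 _≅_ _⟶_ _⇒_

data _≅_ {n : ℕ} : Proc n → Proc n → Set where
  ≅-refl  : ∀ {P} → P ≅ P
  ≅-sym   : ∀ {P Q} → P ≅ Q → Q ≅ P
  ≅-trans : ∀ {P Q R} → P ≅ Q → Q ≅ R → P ≅ R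
  par-nil   : ∀ {P} → par P nil ≅ P
  par-comm  : ∀ {P Q} → par P Q ≅ par Q P
  par-assoc : ∀ {P Q R} → par P (par Q R) ≅ par (par P Q) R
  nu-swap   : ∀ {P} → nu (nu P) ≅ nu (nu (renP swap P))
  nu-extr   : ∀ {P Q} → nu (par P (wk Q)) ≅ par (nu P) Q
  c-par    : ∀ {P P' Q Q'} → P ≅ P' → Q ≅ Q' → par P Q ≅ par P' Q'
  c-rep    : ∀ {a k P P'} → P ≅ P' → rep a k P ≅ rep a k P'
  c-inp    : ∀ {a k P P'} → P ≅ P' → inp a k P ≅ inp a k P'
  c-nu     : ∀ {P P'} → P ≅ P' → nu P ≅ nu P'
  c-matchN : ∀ {e P P' Q Q'} → P ≅ P' → Q ≅ Q' → matchN e P Q ≅ matchN e P' Q'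
  c-matchL : ∀ {e P P' Q Q'} → P ≅ P' → Q ≅ Q' → matchL e P Q ≅ matchL e P' Q'
  c-ite    : ∀ {e P P' Q Q'} → P ≅ P' → Q ≅ Q' → ite e P Q ≅ ite e P' Q'
  c-tick   : ∀ {P P'} → P ≅ P' → tick P ≅ tick P'

data _⟶_ {n : ℕ} : Proc n → Proc n → Set where
  r-rep : ∀ {a k P P'} {es : Vec (Exp n) k} → subP (inst es) P ≡ just P' →
          par (rep a k P) (out a es) ⟶ par (rep a k P) P'
  r-inp : ∀ {a k P P'} {es : Vec (Exp n) k} → subP (inst es) P ≡ just P' →
          par (inp a k P) (out a es) ⟶ P'
  r-mz  : ∀ {P Q} → matchN ezero P Q ⟶ P
  r-ms  : ∀ {e P Q Q'} → subP (inst1 e) Q ≡ just Q' → matchN (esuc e) P Q ⟶ Q'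
  r-mn  : ∀ {P Q} → matchL enil P Q ⟶ P
  r-mc  : ∀ {e e' P Q Q'} → subP (inst2 e e') Q ≡ just Q' → matchL (econs e e') P Q ⟶ Q'
  r-tt  : ∀ {P Q} → ite ett P Q ⟶ P
  r-ff  : ∀ {P Q} → ite eff P Q ⟶ Q
  r-par : ∀ {P Q R} → P ⟶ Q → par P R ⟶ par Q R
  r-nu  : ∀ {P Q : Proc (suc n)} → P ⟶ Q → nu P ⟶ nu Q
  r-str : ∀ {P P' Q' Q} → P ≅ P' → P' ⟶ Q' → Q' ≅ Q → P ⟶ Q

_⟶*_ : ∀ {n} → Proc n → Proc n → Set
_⟶*_ = Star _⟶_

NF : ∀ {n} → Proc n → Set
NF P = ¬ ∃ λ Q → P ⟶ Q

data _⇒_ {n : ℕ} : Proc n → Proc n → Set where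
  t-nil    : nil ⇒ nil
  t-rep    : ∀ {a k P} → rep a k P ⇒ rep a k P
  t-inp    : ∀ {a k P} → inp a k P ⇒ inp a k P
  t-out    : ∀ {a k} {es : Vec (Exp n) k} → out a es ⇒ out a es
  t-matchN : ∀ {e P Q} → matchN e P Q ⇒ matchN e P Q
  t-matchL : ∀ {e P Q} → matchL e P Q ⇒ matchL e P Q
  t-ite    : ∀ {e P Q} → ite e P Q ⇒ ite e P Q
  t-tick   : ∀ {P} → tick P ⇒ P
  t-par    : ∀ {P P' Q Q'} → P ⇒ P' → Q ⇒ Q' → par P Q ⇒ par P' Q'
  t-nu     : ∀ {P P' : Proc (suc n)} → P ⇒ P' → nu P ⇒ nu P'

data TickLast {n : ℕ} : Proc n → Proc n → Set where
  tl-stop : ∀ {P P'} → P ⟶* P' → NF P' → P' ⇒ P' → TickLast P P'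
  tl-step : ∀ {P P' R Q} → P ⟶* P' → NF P' → ¬ (P' ⇒ P') →
            P' ⇒ R → R ≢ P' → TickLast R Q → TickLast P Q

⌊_⌋ : ∀ {n} → Proc n → Proc n
⌊ nil ⌋ = nil
⌊ par P Q ⌋ = par ⌊ P ⌋ ⌊ Q ⌋
⌊ rep a k P ⌋ = rep a k ⌊ P ⌋
⌊ inp a k P ⌋ = inp a k ⌊ P ⌋
⌊ out a es ⌋ = out a es
⌊ nu P ⌋ = nu ⌊ P ⌋
⌊ matchN e P Q ⌋ = matchN e ⌊ P ⌋ ⌊ Q ⌋
⌊ matchL e P Q ⌋ = matchL e ⌊ P ⌋ ⌊ Q ⌋
⌊ ite e P Q ⌋ = ite e ⌊ P ⌋ ⌊ Q ⌋
⌊ tick P ⌋ = ⌊ P ⌋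

-- A run of the strategy erases to a reduction sequence: erasure commutes with renaming,
-- substitution, ≅ and ⟶, and a time step does not change the erasure.
-- For the normal form, reducibility is characterised syntactically (HasRedex): a firing
-- match/if, or an input and an output on the same channel, in active position (under | and ν
-- only), whose substitution into the continuation is defined. HasRedex is invariant under ≅
-- and sees guarded bodies only through which variables occur in channel position, which
-- erasure preserves. As Q ⇒ Q, Q has no tick in active position, so every redex of ⌊ Q ⌋ is
-- already a redex of Q.

module Submission where

open import Defs
open import Data.Bool using (Bool; true; false; T; _∧_)
open import Data.Bool.Properties using (∧-comm; ∧-assoc; ∧-identityʳ; T-∧)
open import Data.Empty using (⊥-elim)
open import Data.Fin using (Fin; zero; suc; splitAt)
open import Data.Fin.Properties using (splitAt-↑ˡ; splitAt-↑ʳ; suc-injective)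
open import Data.Maybe using (just)
open import Data.Nat using (ℕ; suc; _+_)
open import Data.Product using (∃; _×_; _,_)
open import Data.Sum using (inj₁; inj₂)
open import Data.Vec using (Vec; lookup) renaming (map to vmap)
open import Data.Vec.Functional using (Vector; _++_; replicate)
open import Data.Vec.Properties using (lookup-map; map-∘; map-cong)
open import Function using (_∘_; Equivalence)
open import Function.Definitions using (Injective)
open import Relation.Nullary using (¬_)
open import Relation.Binary.PropositionalEquality
open import Relation.Binary.Construct.Closure.ReflexiveTransitive using (_◅◅_; gmap)

open Equivalence using (to; from)

⌊⌋-renP : ∀ {n m} (ρ : Fin n → Fin m) P → ⌊ renP ρ P ⌋ ≡ renP ρ ⌊ P ⌋
⌊⌋-renP ρ nil = refl
⌊⌋-renP ρ (par P Q) = cong₂ par (⌊⌋-renP ρ P) (⌊⌋-renP ρ Q)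
⌊⌋-renP ρ (rep a k P) = cong (rep (ρ a) k) (⌊⌋-renP _ P)
⌊⌋-renP ρ (inp a k P) = cong (inp (ρ a) k) (⌊⌋-renP _ P)
⌊⌋-renP ρ (out a es) = refl
⌊⌋-renP ρ (nu P) = cong nu (⌊⌋-renP _ P)
⌊⌋-renP ρ (matchN e P Q) = cong₂ (matchN (renE ρ e)) (⌊⌋-renP ρ P) (⌊⌋-renP _ Q)
⌊⌋-renP ρ (matchL e P Q) = cong₂ (matchL (renE ρ e)) (⌊⌋-renP ρ P) (⌊⌋-renP _ Q)
⌊⌋-renP ρ (ite e P Q) = cong₂ (ite (renE ρ e)) (⌊⌋-renP ρ P) (⌊⌋-renP ρ Q)
⌊⌋-renP ρ (tick P) = ⌊⌋-renP ρ P

⌊⌋-subP : ∀ {n m} (σ : Fin n → Exp m) P {P'} → subP σ P ≡ just P' → subP σ ⌊ P ⌋ ≡ just ⌊ P' ⌋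
⌊⌋-subP σ nil refl = refl
⌊⌋-subP σ (par P Q) eq with subP σ P in eP | subP σ Q in eQ | eq
... | just _ | just _ | refl rewrite ⌊⌋-subP σ P eP | ⌊⌋-subP σ Q eQ = refl
⌊⌋-subP σ (rep a k P) eq with asName (σ a) | subP (liftˢ k σ) P in eP | eq
... | just _ | just _ | refl rewrite ⌊⌋-subP _ P eP = refl
⌊⌋-subP σ (inp a k P) eq with asName (σ a) | subP (liftˢ k σ) P in eP | eq
... | just _ | just _ | refl rewrite ⌊⌋-subP _ P eP = refl
⌊⌋-subP σ (out a es) eq with asName (σ a) | eq
... | just _ | refl = refl
⌊⌋-subP σ (nu P) eq with subP (liftˢ 1 σ) P in eP | eq
... | just _ | refl rewrite ⌊⌋-subP _ P eP = refl
⌊⌋-subP σ (matchN e P Q) eq with subP σ P in eP | subP (liftˢ 1 σ) Q in eQ | eq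
... | just _ | just _ | refl rewrite ⌊⌋-subP σ P eP | ⌊⌋-subP _ Q eQ = refl
⌊⌋-subP σ (matchL e P Q) eq with subP σ P in eP | subP (liftˢ 2 σ) Q in eQ | eq
... | just _ | just _ | refl rewrite ⌊⌋-subP σ P eP | ⌊⌋-subP _ Q eQ = refl
⌊⌋-subP σ (ite e P Q) eq with subP σ P in eP | subP σ Q in eQ | eq
... | just _ | just _ | refl rewrite ⌊⌋-subP σ P eP | ⌊⌋-subP σ Q eQ = refl
⌊⌋-subP σ (tick P) eq with subP σ P in eP | eq
... | just _ | refl = ⌊⌋-subP σ P eP

⌊⌋-≅ : ∀ {n} {P Q : Proc n} → P ≅ Q → ⌊ P ⌋ ≅ ⌊ Q ⌋
⌊⌋-≅ ≅-refl = ≅-refl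
⌊⌋-≅ (≅-sym d) = ≅-sym (⌊⌋-≅ d)
⌊⌋-≅ (≅-trans d d') = ≅-trans (⌊⌋-≅ d) (⌊⌋-≅ d')
⌊⌋-≅ par-nil = par-nil
⌊⌋-≅ par-comm = par-comm
⌊⌋-≅ par-assoc = par-assoc
⌊⌋-≅ (nu-swap {P = P}) rewrite ⌊⌋-renP swap P = nu-swap
⌊⌋-≅ (nu-extr {Q = Q}) rewrite ⌊⌋-renP suc Q = nu-extr
⌊⌋-≅ (c-par d d') = c-par (⌊⌋-≅ d) (⌊⌋-≅ d')
⌊⌋-≅ (c-rep d) = c-rep (⌊⌋-≅ d)
⌊⌋-≅ (c-inp d) = c-inp (⌊⌋-≅ d)
⌊⌋-≅ (c-nu d) = c-nu (⌊⌋-≅ d)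
⌊⌋-≅ (c-matchN d d') = c-matchN (⌊⌋-≅ d) (⌊⌋-≅ d')
⌊⌋-≅ (c-matchL d d') = c-matchL (⌊⌋-≅ d) (⌊⌋-≅ d')
⌊⌋-≅ (c-ite d d') = c-ite (⌊⌋-≅ d) (⌊⌋-≅ d')
⌊⌋-≅ (c-tick d) = ⌊⌋-≅ d

⌊⌋-⟶ : ∀ {n} {P Q : Proc n} → P ⟶ Q → ⌊ P ⌋ ⟶ ⌊ Q ⌋
⌊⌋-⟶ (r-rep {P = P} eq) = r-rep (⌊⌋-subP _ P eq)
⌊⌋-⟶ (r-inp {P = P} eq) = r-inp (⌊⌋-subP _ P eq)
⌊⌋-⟶ r-mz = r-mz
⌊⌋-⟶ (r-ms {Q = Q} eq) = r-ms (⌊⌋-subP _ Q eq)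
⌊⌋-⟶ r-mn = r-mn
⌊⌋-⟶ (r-mc {Q = Q} eq) = r-mc (⌊⌋-subP _ Q eq)
⌊⌋-⟶ r-tt = r-tt
⌊⌋-⟶ r-ff = r-ff
⌊⌋-⟶ (r-par r) = r-par (⌊⌋-⟶ r)
⌊⌋-⟶ (r-nu r) = r-nu (⌊⌋-⟶ r)
⌊⌋-⟶ (r-str d r d') = r-str (⌊⌋-≅ d) (⌊⌋-⟶ r) (⌊⌋-≅ d')

⌊⌋-⟶* : ∀ {n} {P Q : Proc n} → P ⟶* Q → ⌊ P ⌋ ⟶* ⌊ Q ⌋
⌊⌋-⟶* = gmap ⌊_⌋ ⌊⌋-⟶

⌊⌋-⇒ : ∀ {n} {P Q : Proc n} → P ⇒ Q → ⌊ P ⌋ ≡ ⌊ Q ⌋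
⌊⌋-⇒ t-nil = refl
⌊⌋-⇒ t-rep = refl
⌊⌋-⇒ t-inp = refl
⌊⌋-⇒ t-out = refl
⌊⌋-⇒ t-matchN = refl
⌊⌋-⇒ t-matchL = refl
⌊⌋-⇒ t-ite = refl
⌊⌋-⇒ t-tick = refl
⌊⌋-⇒ (t-par d d') = cong₂ par (⌊⌋-⇒ d) (⌊⌋-⇒ d')
⌊⌋-⇒ (t-nu d) = cong nu (⌊⌋-⇒ d)

bound : ∀ {n} k → Vector Bool n → Vector Bool (k + n)
bound k S = replicate k true ++ S

-- For S = isName ∘ σ, channelsAre S P decides whether subP σ P is defined; variables bound
-- inside P are marked since liftˢ maps them to names.
channelsAre : ∀ {n} → Vector Bool n → Proc n → Bool
channelsAre S nil = true
channelsAre S (par P Q) = channelsAre S P ∧ channelsAre S Q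
channelsAre S (rep a k P) = S a ∧ channelsAre (bound k S) P
channelsAre S (inp a k P) = S a ∧ channelsAre (bound k S) P
channelsAre S (out a es) = S a
channelsAre S (nu P) = channelsAre (bound 1 S) P
channelsAre S (matchN e P Q) = channelsAre S P ∧ channelsAre (bound 1 S) Q
channelsAre S (matchL e P Q) = channelsAre S P ∧ channelsAre (bound 2 S) Q
channelsAre S (ite e P Q) = channelsAre S P ∧ channelsAre S Q
channelsAre S (tick P) = channelsAre S P

++-liftʳ : ∀ {k n m} (f : Vector Bool k) {S : Vector Bool m} {S' : Vector Bool n} {ρ : Fin n → Fin m} →
  (∀ i → S (ρ i) ≡ S' i) → ∀ i → (f ++ S) (liftʳ k ρ i) ≡ (f ++ S') i
++-liftʳ {k} {m = m} f {ρ = ρ} h i with splitAt k i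
... | inj₁ j rewrite splitAt-↑ˡ k j m = refl
... | inj₂ j rewrite splitAt-↑ʳ k m (ρ j) = h j

channelsAre-renP : ∀ {n m} {ρ : Fin n → Fin m} {S S'} → (∀ i → S (ρ i) ≡ S' i) →
  ∀ P → channelsAre S (renP ρ P) ≡ channelsAre S' P
channelsAre-renP h nil = refl
channelsAre-renP h (par P Q) = cong₂ _∧_ (channelsAre-renP h P) (channelsAre-renP h Q)
channelsAre-renP h (rep a k P) = cong₂ _∧_ (h a) (channelsAre-renP (++-liftʳ _ h) P)
channelsAre-renP h (inp a k P) = cong₂ _∧_ (h a) (channelsAre-renP (++-liftʳ _ h) P)
channelsAre-renP h (out a es) = h a
channelsAre-renP h (nu P) = channelsAre-renP (++-liftʳ _ h) P
channelsAre-renP h (matchN e P Q) = cong₂ _∧_ (channelsAre-renP h P) (channelsAre-renP (++-liftʳ _ h) Q)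
channelsAre-renP h (matchL e P Q) = cong₂ _∧_ (channelsAre-renP h P) (channelsAre-renP (++-liftʳ _ h) Q)
channelsAre-renP h (ite e P Q) = cong₂ _∧_ (channelsAre-renP h P) (channelsAre-renP h Q)
channelsAre-renP h (tick P) = channelsAre-renP h P

channelsAre-⌊⌋ : ∀ {n} (S : Vector Bool n) P → channelsAre S ⌊ P ⌋ ≡ channelsAre S P
channelsAre-⌊⌋ S nil = refl
channelsAre-⌊⌋ S (par P Q) = cong₂ _∧_ (channelsAre-⌊⌋ S P) (channelsAre-⌊⌋ S Q)
channelsAre-⌊⌋ S (rep a k P) = cong (S a ∧_) (channelsAre-⌊⌋ _ P)
channelsAre-⌊⌋ S (inp a k P) = cong (S a ∧_) (channelsAre-⌊⌋ _ P)
channelsAre-⌊⌋ S (out a es) = refl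
channelsAre-⌊⌋ S (nu P) = channelsAre-⌊⌋ _ P
channelsAre-⌊⌋ S (matchN e P Q) = cong₂ _∧_ (channelsAre-⌊⌋ S P) (channelsAre-⌊⌋ _ Q)
channelsAre-⌊⌋ S (matchL e P Q) = cong₂ _∧_ (channelsAre-⌊⌋ S P) (channelsAre-⌊⌋ _ Q)
channelsAre-⌊⌋ S (ite e P Q) = cong₂ _∧_ (channelsAre-⌊⌋ S P) (channelsAre-⌊⌋ S Q)
channelsAre-⌊⌋ S (tick P) = channelsAre-⌊⌋ S P

swap-swap : ∀ {n} (x : Fin (suc (suc n))) → swap (swap x) ≡ x
swap-swap zero = refl
swap-swap (suc zero) = refl
swap-swap (suc (suc x)) = refl

bound-swap : ∀ {n} (S : Vector Bool n) i → bound 1 (bound 1 S) (swap i) ≡ bound 1 (bound 1 S) i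
bound-swap S zero = refl
bound-swap S (suc zero) = refl
bound-swap S (suc (suc i)) = refl

channelsAre-≅ : ∀ {n} {P Q : Proc n} {S} → P ≅ Q → channelsAre S P ≡ channelsAre S Q
channelsAre-≅ ≅-refl = refl
channelsAre-≅ (≅-sym d) = sym (channelsAre-≅ d)
channelsAre-≅ (≅-trans d d') = trans (channelsAre-≅ d) (channelsAre-≅ d')
channelsAre-≅ par-nil = ∧-identityʳ _
channelsAre-≅ {S = S} (par-comm {P} {Q}) = ∧-comm (channelsAre S P) (channelsAre S Q)
channelsAre-≅ {S = S} (par-assoc {P} {Q} {R}) = sym (∧-assoc (channelsAre S P) (channelsAre S Q) (channelsAre S R))
channelsAre-≅ {S = S} (nu-swap {P = P}) = sym (channelsAre-renP (bound-swap S) P)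
channelsAre-≅ (nu-extr {Q = Q}) = cong (_ ∧_) (channelsAre-renP {ρ = suc} (λ _ → refl) Q)
channelsAre-≅ (c-par d d') = cong₂ _∧_ (channelsAre-≅ d) (channelsAre-≅ d')
channelsAre-≅ {S = S} (c-rep {a = a} d) = cong (S a ∧_) (channelsAre-≅ d)
channelsAre-≅ {S = S} (c-inp {a = a} d) = cong (S a ∧_) (channelsAre-≅ d)
channelsAre-≅ (c-nu d) = channelsAre-≅ d
channelsAre-≅ (c-matchN d d') = cong₂ _∧_ (channelsAre-≅ d) (channelsAre-≅ d')
channelsAre-≅ (c-matchL d d') = cong₂ _∧_ (channelsAre-≅ d) (channelsAre-≅ d')
channelsAre-≅ (c-ite d d') = cong₂ _∧_ (channelsAre-≅ d) (channelsAre-≅ d')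
channelsAre-≅ (c-tick d) = channelsAre-≅ d

isName : ∀ {m} → Exp m → Bool
isName (var _) = true
isName _ = false

isName-renE : ∀ {n m} (ρ : Fin n → Fin m) e → isName (renE ρ e) ≡ isName e
isName-renE ρ (var x) = refl
isName-renE ρ ezero = refl
isName-renE ρ (esuc e) = refl
isName-renE ρ enil = refl
isName-renE ρ (econs e e') = refl
isName-renE ρ ett = refl
isName-renE ρ eff = refl

isName-liftˢ : ∀ {k n m} {σ : Fin n → Exp m} {S} → (∀ i → isName (σ i) ≡ S i) →
  ∀ i → isName (liftˢ k σ i) ≡ bound k S i
isName-liftˢ {k} {σ = σ} h i with splitAt k i
... | inj₁ j = refl
... | inj₂ j = trans (isName-renE _ (σ j)) (h j)

asName-defined : ∀ {m} {e : Exp m} → T (isName e) → ∃ λ b → asName e ≡ just b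
asName-defined {e = var x} _ = x , refl

asName-just⇒isName : ∀ {m} (e : Exp m) {b} → asName e ≡ just b → T (isName e)
asName-just⇒isName (var x) _ = _

subP-defined : ∀ {n m} {σ : Fin n → Exp m} {S} → (∀ i → isName (σ i) ≡ S i) →
  ∀ P → T (channelsAre S P) → ∃ λ P' → subP σ P ≡ just P'
subP-defined h nil _ = nil , refl
subP-defined h (par P Q) t with to T-∧ t
... | tP , tQ with subP-defined h P tP | subP-defined h Q tQ
... | _ , eP | _ , eQ rewrite eP | eQ = _ , refl
subP-defined h (rep a k P) t with to T-∧ t
... | ta , tP with asName-defined (subst T (sym (h a)) ta) | subP-defined (isName-liftˢ h) P tP
... | _ , ea | _ , eP rewrite ea | eP = _ , refl
subP-defined h (inp a k P) t with to T-∧ t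
... | ta , tP with asName-defined (subst T (sym (h a)) ta) | subP-defined (isName-liftˢ h) P tP
... | _ , ea | _ , eP rewrite ea | eP = _ , refl
subP-defined h (out a es) t with asName-defined (subst T (sym (h a)) t)
... | _ , ea rewrite ea = _ , refl
subP-defined h (nu P) t with subP-defined (isName-liftˢ h) P t
... | _ , eP rewrite eP = _ , refl
subP-defined h (matchN e P Q) t with to T-∧ t
... | tP , tQ with subP-defined h P tP | subP-defined (isName-liftˢ h) Q tQ
... | _ , eP | _ , eQ rewrite eP | eQ = _ , refl
subP-defined h (matchL e P Q) t with to T-∧ t
... | tP , tQ with subP-defined h P tP | subP-defined (isName-liftˢ h) Q tQ
... | _ , eP | _ , eQ rewrite eP | eQ = _ , refl
subP-defined h (ite e P Q) t with to T-∧ t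
... | tP , tQ with subP-defined h P tP | subP-defined h Q tQ
... | _ , eP | _ , eQ rewrite eP | eQ = _ , refl
subP-defined h (tick P) t with subP-defined h P t
... | _ , eP rewrite eP = _ , refl

subP-just⇒channelsAre : ∀ {n m} {σ : Fin n → Exp m} {S} → (∀ i → isName (σ i) ≡ S i) →
  ∀ P {P'} → subP σ P ≡ just P' → T (channelsAre S P)
subP-just⇒channelsAre h nil _ = _
subP-just⇒channelsAre {σ = σ} h (par P Q) _ with subP σ P in eP | subP σ Q in eQ
... | just _ | just _ = from T-∧ (subP-just⇒channelsAre h P eP , subP-just⇒channelsAre h Q eQ)
subP-just⇒channelsAre {σ = σ} h (rep a k P) _ with asName (σ a) in ea | subP (liftˢ k σ) P in eP
... | just _ | just _ =
  from T-∧ (subst T (h a) (asName-just⇒isName (σ a) ea) , subP-just⇒channelsAre (isName-liftˢ h) P eP)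
subP-just⇒channelsAre {σ = σ} h (inp a k P) _ with asName (σ a) in ea | subP (liftˢ k σ) P in eP
... | just _ | just _ =
  from T-∧ (subst T (h a) (asName-just⇒isName (σ a) ea) , subP-just⇒channelsAre (isName-liftˢ h) P eP)
subP-just⇒channelsAre {σ = σ} h (out a es) _ with asName (σ a) in ea
... | just _ = subst T (h a) (asName-just⇒isName (σ a) ea)
subP-just⇒channelsAre {σ = σ} h (nu P) _ with subP (liftˢ 1 σ) P in eP
... | just _ = subP-just⇒channelsAre (isName-liftˢ h) P eP
subP-just⇒channelsAre {σ = σ} h (matchN e P Q) _ with subP σ P in eP | subP (liftˢ 1 σ) Q in eQ
... | just _ | just _ = from T-∧ (subP-just⇒channelsAre h P eP , subP-just⇒channelsAre (isName-liftˢ h) Q eQ)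
subP-just⇒channelsAre {σ = σ} h (matchL e P Q) _ with subP σ P in eP | subP (liftˢ 2 σ) Q in eQ
... | just _ | just _ = from T-∧ (subP-just⇒channelsAre h P eP , subP-just⇒channelsAre (isName-liftˢ h) Q eQ)
subP-just⇒channelsAre {σ = σ} h (ite e P Q) _ with subP σ P in eP | subP σ Q in eQ
... | just _ | just _ = from T-∧ (subP-just⇒channelsAre h P eP , subP-just⇒channelsAre h Q eQ)
subP-just⇒channelsAre {σ = σ} h (tick P) _ with subP σ P in eP
... | just _ = subP-just⇒channelsAre h P eP

argNames : ∀ {k n} → Vec Bool k → Vector Bool (k + n)
argNames ns = lookup ns ++ replicate _ true

isName-inst : ∀ {k n} (es : Vec (Exp n) k) i → isName (inst es i) ≡ argNames (vmap isName es) i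
isName-inst {k} es i with splitAt k i
... | inj₁ j = sym (lookup-map j isName es)
... | inj₂ j = refl

isName-inst1-renE : ∀ {n m} (ρ : Fin n → Fin m) e i →
  isName (inst1 (renE ρ e) (liftʳ 1 ρ i)) ≡ isName (inst1 e i)
isName-inst1-renE ρ e zero = isName-renE ρ e
isName-inst1-renE ρ e (suc i) = refl

isName-inst2-renE : ∀ {n m} (ρ : Fin n → Fin m) e e' i →
  isName (inst2 (renE ρ e) (renE ρ e') (liftʳ 2 ρ i)) ≡ isName (inst2 e e' i)
isName-inst2-renE ρ e e' zero = isName-renE ρ e
isName-inst2-renE ρ e e' (suc zero) = isName-renE ρ e'
isName-inst2-renE ρ e e' (suc (suc i)) = refl

data LocalRedex {n : ℕ} : Proc n → Set where
  zero-match : ∀ {P Q} → LocalRedex (matchN ezero P Q)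
  suc-match  : ∀ {e P Q} → T (channelsAre (isName ∘ inst1 e) Q) → LocalRedex (matchN (esuc e) P Q)
  nil-match  : ∀ {P Q} → LocalRedex (matchL enil P Q)
  cons-match : ∀ {e e' P Q} → T (channelsAre (isName ∘ inst2 e e') Q) → LocalRedex (matchL (econs e e') P Q)
  if-true    : ∀ {P Q} → LocalRedex (ite ett P Q)
  if-false   : ∀ {P Q} → LocalRedex (ite eff P Q)

LocalRedex-renP : ∀ {n m} {X : Proc n} (ρ : Fin n → Fin m) → LocalRedex X → LocalRedex (renP ρ X)
LocalRedex-renP ρ zero-match = zero-match
LocalRedex-renP ρ (suc-match {e = e} {Q = Q} t) =
  suc-match (subst T (sym (channelsAre-renP (isName-inst1-renE ρ e) Q)) t)
LocalRedex-renP ρ nil-match = nil-match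
LocalRedex-renP ρ (cons-match {e = e} {e'} {Q = Q} t) =
  cons-match (subst T (sym (channelsAre-renP (isName-inst2-renE ρ e e') Q)) t)
LocalRedex-renP ρ if-true = if-true
LocalRedex-renP ρ if-false = if-false

LocalRedex-unrenP : ∀ {n m} (ρ : Fin n → Fin m) (X : Proc n) → LocalRedex (renP ρ X) → LocalRedex X
LocalRedex-unrenP ρ (matchN ezero P Q) _ = zero-match
LocalRedex-unrenP ρ (matchN (esuc e) P Q) (suc-match t) =
  suc-match (subst T (channelsAre-renP (isName-inst1-renE ρ e) Q) t)
LocalRedex-unrenP ρ (matchL enil P Q) _ = nil-match
LocalRedex-unrenP ρ (matchL (econs e e') P Q) (cons-match t) =
  cons-match (subst T (channelsAre-renP (isName-inst2-renE ρ e e') Q) t)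
LocalRedex-unrenP ρ (ite ett P Q) _ = if-true
LocalRedex-unrenP ρ (ite eff P Q) _ = if-false
LocalRedex-unrenP ρ (matchN (var _) P Q) ()
LocalRedex-unrenP ρ (matchN enil P Q) ()
LocalRedex-unrenP ρ (matchN (econs _ _) P Q) ()
LocalRedex-unrenP ρ (matchN ett P Q) ()
LocalRedex-unrenP ρ (matchN eff P Q) ()
LocalRedex-unrenP ρ (matchL (var _) P Q) ()
LocalRedex-unrenP ρ (matchL ezero P Q) ()
LocalRedex-unrenP ρ (matchL (esuc _) P Q) ()
LocalRedex-unrenP ρ (matchL ett P Q) ()
LocalRedex-unrenP ρ (matchL eff P Q) ()
LocalRedex-unrenP ρ (ite (var _) P Q) ()
LocalRedex-unrenP ρ (ite ezero P Q) ()
LocalRedex-unrenP ρ (ite (esuc _) P Q) ()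
LocalRedex-unrenP ρ (ite enil P Q) ()
LocalRedex-unrenP ρ (ite (econs _ _) P Q) ()

LocalRedex-⌊⌋ : ∀ {n} (X : Proc n) → X ⇒ X → LocalRedex ⌊ X ⌋ → LocalRedex X
LocalRedex-⌊⌋ (matchN e P Q) _ zero-match = zero-match
LocalRedex-⌊⌋ (matchN e P Q) _ (suc-match t) = suc-match (subst T (channelsAre-⌊⌋ _ Q) t)
LocalRedex-⌊⌋ (matchL e P Q) _ nil-match = nil-match
LocalRedex-⌊⌋ (matchL e P Q) _ (cons-match t) = cons-match (subst T (channelsAre-⌊⌋ _ Q) t)
LocalRedex-⌊⌋ (ite e P Q) _ if-true = if-true
LocalRedex-⌊⌋ (ite e P Q) _ if-false = if-false
LocalRedex-⌊⌋ (tick X) () _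

LocalRedex-matchN-≅ : ∀ {n} {e} {P P' : Proc n} {Q Q'} → Q ≅ Q' →
  LocalRedex (matchN e P Q) → LocalRedex (matchN e P' Q')
LocalRedex-matchN-≅ d zero-match = zero-match
LocalRedex-matchN-≅ d (suc-match t) = suc-match (subst T (channelsAre-≅ d) t)

LocalRedex-matchL-≅ : ∀ {n} {e} {P P' : Proc n} {Q Q'} → Q ≅ Q' →
  LocalRedex (matchL e P Q) → LocalRedex (matchL e P' Q')
LocalRedex-matchL-≅ d nil-match = nil-match
LocalRedex-matchL-≅ d (cons-match t) = cons-match (subst T (channelsAre-≅ d) t)

LocalRedex-ite : ∀ {n} {e} {P P' Q Q' : Proc n} → LocalRedex (ite e P Q) → LocalRedex (ite e P' Q')
LocalRedex-ite if-true = if-true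
LocalRedex-ite if-false = if-false

data Polarity : Set where
  input output : Polarity

data Prefix {k : ℕ} (ns : Vec Bool k) {n : ℕ} : Polarity → Fin n → Proc n → Set where
  rep-prefix : ∀ {a B} → T (channelsAre (argNames ns) B) → Prefix ns input a (rep a k B)
  inp-prefix : ∀ {a B} → T (channelsAre (argNames ns) B) → Prefix ns input a (inp a k B)
  out-prefix : ∀ {a} {es : Vec (Exp n) k} → vmap isName es ≡ ns → Prefix ns output a (out a es)

argNames-liftʳ : ∀ {k n m} (ns : Vec Bool k) (ρ : Fin n → Fin m) i →
  argNames {n = m} ns (liftʳ k ρ i) ≡ argNames ns i
argNames-liftʳ ns ρ = ++-liftʳ (lookup ns) (λ _ → refl)

isNames-renE : ∀ {n m k} (ρ : Fin n → Fin m) (es : Vec (Exp n) k) →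
  vmap isName (vmap (renE ρ) es) ≡ vmap isName es
isNames-renE ρ es = trans (sym (map-∘ isName (renE ρ) es)) (map-cong (isName-renE ρ) es)

module _ {k} {ns : Vec Bool k} {π : Polarity} where

  Prefix-renP : ∀ {n m} {c : Fin n} {X} (ρ : Fin n → Fin m) →
    Prefix ns π c X → Prefix ns π (ρ c) (renP ρ X)
  Prefix-renP ρ (rep-prefix {B = B} t) = rep-prefix (subst T (sym (channelsAre-renP (argNames-liftʳ ns ρ) B)) t)
  Prefix-renP ρ (inp-prefix {B = B} t) = inp-prefix (subst T (sym (channelsAre-renP (argNames-liftʳ ns ρ) B)) t)
  Prefix-renP ρ (out-prefix {es = es} e) = out-prefix (trans (isNames-renE ρ es) e)

  Prefix-unrenP : ∀ {n m} {c : Fin m} (ρ : Fin n → Fin m) X → Prefix ns π c (renP ρ X) →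
    ∃ λ c' → ρ c' ≡ c × Prefix ns π c' X
  Prefix-unrenP ρ (rep a _ B) (rep-prefix t) =
    a , refl , rep-prefix (subst T (channelsAre-renP (argNames-liftʳ ns ρ) B) t)
  Prefix-unrenP ρ (inp a _ B) (inp-prefix t) =
    a , refl , inp-prefix (subst T (channelsAre-renP (argNames-liftʳ ns ρ) B) t)
  Prefix-unrenP ρ (out a es) (out-prefix e) = a , refl , out-prefix (trans (sym (isNames-renE ρ es)) e)

  Prefix-⌊⌋ : ∀ {n} {c : Fin n} X → X ⇒ X → Prefix ns π c ⌊ X ⌋ → Prefix ns π c X
  Prefix-⌊⌋ (rep a _ B) _ (rep-prefix t) = rep-prefix (subst T (channelsAre-⌊⌋ _ B) t)
  Prefix-⌊⌋ (inp a _ B) _ (inp-prefix t) = inp-prefix (subst T (channelsAre-⌊⌋ _ B) t)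
  Prefix-⌊⌋ (out a es) _ (out-prefix e) = out-prefix e
  Prefix-⌊⌋ (tick X) () _

  data Active {n : ℕ} : Fin n → Proc n → Set where
    here  : ∀ {c X} → Prefix ns π c X → Active c X
    left  : ∀ {c X Y} → Active c X → Active c (par X Y)
    right : ∀ {c X Y} → Active c Y → Active c (par X Y)
    under : ∀ {c X} → Active (suc c) X → Active c (nu X)

  Active-renP : ∀ {n m} {c : Fin n} {X} (ρ : Fin n → Fin m) → Active c X → Active (ρ c) (renP ρ X)
  Active-renP ρ (here p) = here (Prefix-renP ρ p)
  Active-renP ρ (left a) = left (Active-renP ρ a)
  Active-renP ρ (right a) = right (Active-renP ρ a)
  Active-renP ρ (under a) = under (Active-renP (liftʳ 1 ρ) a)

  Active-unrenP : ∀ {n m} {c : Fin m} (ρ : Fin n → Fin m) X → Active c (renP ρ X) →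
    ∃ λ c' → ρ c' ≡ c × Active c' X
  Active-unrenP ρ (par X Y) (left a) with Active-unrenP ρ X a
  ... | c' , e , a' = c' , e , left a'
  Active-unrenP ρ (par X Y) (right a) with Active-unrenP ρ Y a
  ... | c' , e , a' = c' , e , right a'
  Active-unrenP ρ (nu X) (under a) with Active-unrenP (liftʳ 1 ρ) X a
  ... | suc c' , refl , a' = c' , refl , under a'
  Active-unrenP ρ X (here p) with Prefix-unrenP ρ X p
  ... | c' , e , p' = c' , e , here p'

  Active-⌊⌋ : ∀ {n} {c : Fin n} X → X ⇒ X → Active c ⌊ X ⌋ → Active c X
  Active-⌊⌋ (tick X) () _
  Active-⌊⌋ (par X Y) (t-par d d') (left a) = left (Active-⌊⌋ X d a)
  Active-⌊⌋ (par X Y) (t-par d d') (right a) = right (Active-⌊⌋ Y d' a)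
  Active-⌊⌋ (nu X) (t-nu d) (under a) = under (Active-⌊⌋ X d a)
  Active-⌊⌋ X d (here p) = here (Prefix-⌊⌋ X d p)

  Active-zero-wk : ∀ {n} {P : Proc (suc n)} {Q} → Active zero (par P (wk Q)) → Active zero P
  Active-zero-wk (left a) = a
  Active-zero-wk {Q = Q} (right a) with Active-unrenP suc Q a
  ... | _ , () , _

  Active-≅ : ∀ {n} {c : Fin n} {P Q} → P ≅ Q → Active c P → Active c Q
  Active-≅˘ : ∀ {n} {c : Fin n} {P Q} → P ≅ Q → Active c Q → Active c P

  Active-≅ ≅-refl a = a
  Active-≅ (≅-sym d) a = Active-≅˘ d a
  Active-≅ (≅-trans d d') a = Active-≅ d' (Active-≅ d a)
  Active-≅ par-nil (left a) = a
  Active-≅ par-nil (right (here ()))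
  Active-≅ par-comm (left a) = right a
  Active-≅ par-comm (right a) = left a
  Active-≅ par-assoc (left a) = left (left a)
  Active-≅ par-assoc (right (left a)) = left (right a)
  Active-≅ par-assoc (right (right a)) = right a
  Active-≅ nu-swap (under (under a)) = under (under (Active-renP swap a))
  Active-≅ nu-extr (under (left a)) = left (under a)
  Active-≅ (nu-extr {Q = Q}) (under (right a)) with Active-unrenP suc Q a
  ... | _ , refl , a' = right a'
  Active-≅ (c-par d d') (left a) = left (Active-≅ d a)
  Active-≅ (c-par d d') (right a) = right (Active-≅ d' a)
  Active-≅ (c-rep d) (here (rep-prefix t)) = here (rep-prefix (subst T (channelsAre-≅ d) t))
  Active-≅ (c-inp d) (here (inp-prefix t)) = here (inp-prefix (subst T (channelsAre-≅ d) t))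
  Active-≅ (c-nu d) (under a) = under (Active-≅ d a)
  Active-≅ (c-matchN _ _) (here ())
  Active-≅ (c-matchL _ _) (here ())
  Active-≅ (c-ite _ _) (here ())
  Active-≅ (c-tick _) (here ())

  Active-≅˘ ≅-refl a = a
  Active-≅˘ (≅-sym d) a = Active-≅ d a
  Active-≅˘ (≅-trans d d') a = Active-≅˘ d (Active-≅˘ d' a)
  Active-≅˘ par-nil a = left a
  Active-≅˘ par-comm (left a) = right a
  Active-≅˘ par-comm (right a) = left a
  Active-≅˘ par-assoc (left (left a)) = left a
  Active-≅˘ par-assoc (left (right a)) = right (left a)
  Active-≅˘ par-assoc (right a) = right (right a)
  Active-≅˘ (nu-swap {P = P}) (under (under a)) with Active-unrenP swap P a
  ... | c' , e , a' with trans (sym (swap-swap c')) (cong swap e)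
  ... | refl = under (under a')
  Active-≅˘ nu-extr (left (under a)) = under (left a)
  Active-≅˘ nu-extr (right a) = under (right (Active-renP suc a))
  Active-≅˘ (c-par d d') (left a) = left (Active-≅˘ d a)
  Active-≅˘ (c-par d d') (right a) = right (Active-≅˘ d' a)
  Active-≅˘ (c-rep d) (here (rep-prefix t)) = here (rep-prefix (subst T (sym (channelsAre-≅ d)) t))
  Active-≅˘ (c-inp d) (here (inp-prefix t)) = here (inp-prefix (subst T (sym (channelsAre-≅ d)) t))
  Active-≅˘ (c-nu d) (under a) = under (Active-≅˘ d a)
  Active-≅˘ (c-matchN _ _) (here ())
  Active-≅˘ (c-matchL _ _) (here ())
  Active-≅˘ (c-ite _ _) (here ())
  Active-≅˘ (c-tick _) (here ())

Input Output : ∀ {k} → Vec Bool k → ∀ {n} → Fin n → Proc n → Set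
Input ns = Active {ns = ns} {π = input}
Output ns = Active {ns = ns} {π = output}

data HasRedex {n : ℕ} : Proc n → Set where
  local : ∀ {X} → LocalRedex X → HasRedex X
  comm  : ∀ {X k c} {ns : Vec Bool k} → Input ns c X → Output ns c X → HasRedex X
  left  : ∀ {X Y} → HasRedex X → HasRedex (par X Y)
  right : ∀ {X Y} → HasRedex Y → HasRedex (par X Y)
  under : ∀ {X} → HasRedex X → HasRedex (nu X)

¬HasRedex-nil : ∀ {n} → ¬ HasRedex {n} nil
¬HasRedex-nil (local ())
¬HasRedex-nil (comm (here ()) _)

comm-nu : ∀ {n k c} {ns : Vec Bool k} {X : Proc (suc n)} → Input ns c X → Output ns c X → HasRedex (nu X)
comm-nu {c = zero} i o = under (comm i o)
comm-nu {c = suc c} i o = comm (under i) (under o)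

comm-nu-nu : ∀ {n k c} {ns : Vec Bool k} {X : Proc (suc (suc n))} → Input ns c X → Output ns c X →
  HasRedex (nu (nu X))
comm-nu-nu {c = zero} i o = under (comm-nu i o)
comm-nu-nu {c = suc c} i o = comm-nu (under i) (under o)

HasRedex-renP : ∀ {n m} {X : Proc n} (ρ : Fin n → Fin m) → HasRedex X → HasRedex (renP ρ X)
HasRedex-renP ρ (local r) = local (LocalRedex-renP ρ r)
HasRedex-renP ρ (comm i o) = comm (Active-renP ρ i) (Active-renP ρ o)
HasRedex-renP ρ (left h) = left (HasRedex-renP ρ h)
HasRedex-renP ρ (right h) = right (HasRedex-renP ρ h)
HasRedex-renP ρ (under h) = under (HasRedex-renP (liftʳ 1 ρ) h)

liftʳ-injective : ∀ {n m} {ρ : Fin n → Fin m} → Injective _≡_ _≡_ ρ → Injective _≡_ _≡_ (liftʳ 1 ρ)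
liftʳ-injective inj {zero} {zero} _ = refl
liftʳ-injective inj {suc x} {suc y} e = cong suc (inj (suc-injective e))

swap-injective : ∀ {n} → Injective _≡_ _≡_ (swap {n})
swap-injective {x = x} {y} e = trans (sym (swap-swap x)) (trans (cong swap e) (swap-swap y))

comm-unrenP : ∀ {n m k c} {ns : Vec Bool k} {ρ : Fin n → Fin m} → Injective _≡_ _≡_ ρ → ∀ X →
  Input ns c (renP ρ X) → Output ns c (renP ρ X) → HasRedex X
comm-unrenP {ρ = ρ} inj X i o with Active-unrenP ρ X i | Active-unrenP ρ X o
... | c₁ , e₁ , i' | c₂ , e₂ , o' with inj (trans e₁ (sym e₂))
... | refl = comm i' o'

HasRedex-unrenP : ∀ {n m} {ρ : Fin n → Fin m} → Injective _≡_ _≡_ ρ → ∀ X → HasRedex (renP ρ X) → HasRedex X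
HasRedex-unrenP inj X@nil (comm i o) = comm-unrenP inj X i o
HasRedex-unrenP inj X@(par _ _) (comm i o) = comm-unrenP inj X i o
HasRedex-unrenP inj X@(rep _ _ _) (comm i o) = comm-unrenP inj X i o
HasRedex-unrenP inj X@(inp _ _ _) (comm i o) = comm-unrenP inj X i o
HasRedex-unrenP inj X@(out _ _) (comm i o) = comm-unrenP inj X i o
HasRedex-unrenP inj X@(nu _) (comm i o) = comm-unrenP inj X i o
HasRedex-unrenP inj X@(matchN _ _ _) (comm i o) = comm-unrenP inj X i o
HasRedex-unrenP inj X@(matchL _ _ _) (comm i o) = comm-unrenP inj X i o
HasRedex-unrenP inj X@(ite _ _ _) (comm i o) = comm-unrenP inj X i o
HasRedex-unrenP inj X@(tick _) (comm i o) = comm-unrenP inj X i o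
HasRedex-unrenP {ρ = ρ} inj X@(matchN _ _ _) (local r) = local (LocalRedex-unrenP ρ X r)
HasRedex-unrenP {ρ = ρ} inj X@(matchL _ _ _) (local r) = local (LocalRedex-unrenP ρ X r)
HasRedex-unrenP {ρ = ρ} inj X@(ite _ _ _) (local r) = local (LocalRedex-unrenP ρ X r)
HasRedex-unrenP inj (par X Y) (left h) = left (HasRedex-unrenP inj X h)
HasRedex-unrenP inj (par X Y) (right h) = right (HasRedex-unrenP inj Y h)
HasRedex-unrenP inj (nu X) (under h) = under (HasRedex-unrenP (liftʳ-injective inj) X h)

HasRedex-≅ : ∀ {n} {P Q : Proc n} → P ≅ Q → HasRedex P → HasRedex Q
HasRedex-≅˘ : ∀ {n} {P Q : Proc n} → P ≅ Q → HasRedex Q → HasRedex P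

HasRedex-≅ ≅-refl h = h
HasRedex-≅ (≅-sym d) h = HasRedex-≅˘ d h
HasRedex-≅ (≅-trans d d') h = HasRedex-≅ d' (HasRedex-≅ d h)
HasRedex-≅ d (comm i o) = comm (Active-≅ d i) (Active-≅ d o)
HasRedex-≅ par-nil (left h) = h
HasRedex-≅ par-nil (right h) = ⊥-elim (¬HasRedex-nil h)
HasRedex-≅ par-comm (left h) = right h
HasRedex-≅ par-comm (right h) = left h
HasRedex-≅ par-assoc (left h) = left (left h)
HasRedex-≅ par-assoc (right (comm i o)) = comm (Active-≅ par-assoc (right i)) (Active-≅ par-assoc (right o))
HasRedex-≅ par-assoc (right (left h)) = left (right h)
HasRedex-≅ par-assoc (right (right h)) = right h
HasRedex-≅ nu-swap (under (comm (under i) (under o))) = comm-nu-nu (Active-renP swap i) (Active-renP swap o)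
HasRedex-≅ nu-swap (under (under h)) = under (under (HasRedex-renP swap h))
HasRedex-≅ nu-extr (under (comm {c = zero} i o)) = left (under (comm (Active-zero-wk i) (Active-zero-wk o)))
HasRedex-≅ nu-extr (under (comm {c = suc c} i o)) =
  comm (Active-≅ nu-extr (under i)) (Active-≅ nu-extr (under o))
HasRedex-≅ nu-extr (under (left h)) = left (under h)
HasRedex-≅ (nu-extr {Q = Q}) (under (right h)) = right (HasRedex-unrenP suc-injective Q h)
HasRedex-≅ (c-par d d') (left h) = left (HasRedex-≅ d h)
HasRedex-≅ (c-par d d') (right h) = right (HasRedex-≅ d' h)
HasRedex-≅ (c-nu d) (under h) = under (HasRedex-≅ d h)
HasRedex-≅ (c-matchN d d') (local r) = local (LocalRedex-matchN-≅ d' r)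
HasRedex-≅ (c-matchL d d') (local r) = local (LocalRedex-matchL-≅ d' r)
HasRedex-≅ (c-ite d d') (local r) = local (LocalRedex-ite r)

HasRedex-≅˘ ≅-refl h = h
HasRedex-≅˘ (≅-sym d) h = HasRedex-≅ d h
HasRedex-≅˘ (≅-trans d d') h = HasRedex-≅˘ d (HasRedex-≅˘ d' h)
HasRedex-≅˘ d (comm i o) = comm (Active-≅˘ d i) (Active-≅˘ d o)
HasRedex-≅˘ par-nil h = left h
HasRedex-≅˘ par-comm (left h) = right h
HasRedex-≅˘ par-comm (right h) = left h
HasRedex-≅˘ par-assoc (left (comm i o)) = comm (Active-≅˘ par-assoc (left i)) (Active-≅˘ par-assoc (left o))
HasRedex-≅˘ par-assoc (left (left h)) = left h
HasRedex-≅˘ par-assoc (left (right h)) = right (left h)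
HasRedex-≅˘ par-assoc (right h) = right (right h)
HasRedex-≅˘ (nu-swap {P = P}) (under (comm (under i) (under o))) with Active-unrenP swap P i | Active-unrenP swap P o
... | _ , e₁ , i' | _ , e₂ , o' with swap-injective (trans e₁ (sym e₂))
... | refl = comm-nu-nu i' o'
HasRedex-≅˘ (nu-swap {P = P}) (under (under h)) = under (under (HasRedex-unrenP swap-injective P h))
HasRedex-≅˘ nu-extr (left (comm (under i) (under o))) = under (comm (left i) (left o))
HasRedex-≅˘ nu-extr (left (under h)) = under (left h)
HasRedex-≅˘ nu-extr (right h) = under (right (HasRedex-renP suc h))
HasRedex-≅˘ (c-par d d') (left h) = left (HasRedex-≅˘ d h)
HasRedex-≅˘ (c-par d d') (right h) = right (HasRedex-≅˘ d' h)
HasRedex-≅˘ (c-nu d) (under h) = under (HasRedex-≅˘ d h)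
HasRedex-≅˘ (c-matchN d d') (local r) = local (LocalRedex-matchN-≅ (≅-sym d') r)
HasRedex-≅˘ (c-matchL d d') (local r) = local (LocalRedex-matchL-≅ (≅-sym d') r)
HasRedex-≅˘ (c-ite d d') (local r) = local (LocalRedex-ite r)

⟶⇒HasRedex : ∀ {n} {X Y : Proc n} → X ⟶ Y → HasRedex X
⟶⇒HasRedex (r-rep {P = P} {es = es} eq) =
  comm (left (here (rep-prefix (subP-just⇒channelsAre (isName-inst es) P eq)))) (right (here (out-prefix refl)))
⟶⇒HasRedex (r-inp {P = P} {es = es} eq) =
  comm (left (here (inp-prefix (subP-just⇒channelsAre (isName-inst es) P eq)))) (right (here (out-prefix refl)))
⟶⇒HasRedex r-mz = local zero-match
⟶⇒HasRedex (r-ms {Q = Q} eq) = local (suc-match (subP-just⇒channelsAre (λ _ → refl) Q eq))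
⟶⇒HasRedex r-mn = local nil-match
⟶⇒HasRedex (r-mc {Q = Q} eq) = local (cons-match (subP-just⇒channelsAre (λ _ → refl) Q eq))
⟶⇒HasRedex r-tt = local if-true
⟶⇒HasRedex r-ff = local if-false
⟶⇒HasRedex (r-par r) = left (⟶⇒HasRedex r)
⟶⇒HasRedex (r-nu r) = under (⟶⇒HasRedex r)
⟶⇒HasRedex (r-str d r _) = HasRedex-≅˘ d (⟶⇒HasRedex r)

Reducible : ∀ {n} → Proc n → Set
Reducible X = ∃ λ Y → X ⟶ Y

Reducible-par : ∀ {n} {X Y : Proc n} → Reducible X → Reducible (par X Y)
Reducible-par (_ , r) = _ , r-par r

Reducible-nu : ∀ {n} {X : Proc (suc n)} → Reducible X → Reducible (nu X)
Reducible-nu (_ , r) = _ , r-nu r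

Reducible-≅ : ∀ {n} {X Y : Proc n} → X ≅ Y → Reducible Y → Reducible X
Reducible-≅ d (_ , r) = _ , r-str d r ≅-refl

par-exchange : ∀ {n} {X Y Z : Proc n} → par (par X Y) Z ≅ par (par X Z) Y
par-exchange = ≅-trans (≅-sym par-assoc) (≅-trans (c-par ≅-refl par-comm) par-assoc)

LocalRedex⇒Reducible : ∀ {n} {X : Proc n} → LocalRedex X → Reducible X
LocalRedex⇒Reducible zero-match = _ , r-mz
LocalRedex⇒Reducible (suc-match {Q = Q} t) with subP-defined (λ _ → refl) Q t
... | _ , eq = _ , r-ms eq
LocalRedex⇒Reducible nil-match = _ , r-mn
LocalRedex⇒Reducible (cons-match {Q = Q} t) with subP-defined (λ _ → refl) Q t
... | _ , eq = _ , r-mc eq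
LocalRedex⇒Reducible if-true = _ , r-tt
LocalRedex⇒Reducible if-false = _ , r-ff

isName-inst-profile : ∀ {k n} {ns : Vec Bool k} (es : Vec (Exp n) k) → vmap isName es ≡ ns →
  ∀ i → isName (inst es i) ≡ argNames ns i
isName-inst-profile es refl = isName-inst es

prefix-communicates : ∀ {n k c} {ns : Vec Bool k} {X Y : Proc n} →
  Prefix ns input c X → Output ns c Y → Reducible (par X Y)
prefix-communicates (rep-prefix {B = B} t) (here (out-prefix {es = es} e))
  with subP-defined (isName-inst-profile es e) B t
... | _ , eq = _ , r-rep eq
prefix-communicates (inp-prefix {B = B} t) (here (out-prefix {es = es} e))
  with subP-defined (isName-inst-profile es e) B t
... | _ , eq = _ , r-inp eq
prefix-communicates p (left o) = Reducible-≅ par-assoc (Reducible-par (prefix-communicates p o))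
prefix-communicates p (right o) =
  Reducible-≅ (≅-trans (c-par ≅-refl par-comm) par-assoc) (Reducible-par (prefix-communicates p o))
prefix-communicates p (under o) =
  Reducible-≅ (≅-trans par-comm (≅-trans (≅-sym nu-extr) (c-nu par-comm)))
    (Reducible-nu (prefix-communicates (Prefix-renP suc p) o))

communicates : ∀ {n k c} {ns : Vec Bool k} {X Y : Proc n} → Input ns c X → Output ns c Y → Reducible (par X Y)
communicates (here p) o = prefix-communicates p o
communicates (left i) o = Reducible-≅ par-exchange (Reducible-par (communicates i o))
communicates (right i) o =
  Reducible-≅ (≅-trans (c-par par-comm ≅-refl) par-exchange) (Reducible-par (communicates i o))
communicates (under i) o = Reducible-≅ (≅-sym nu-extr) (Reducible-nu (communicates i (Active-renP suc o)))

communicates-within : ∀ {n k c} {ns : Vec Bool k} {X : Proc n} → Input ns c X → Output ns c X → Reducible X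
communicates-within (here (rep-prefix _)) (here ())
communicates-within (here (inp-prefix _)) (here ())
communicates-within (left i) (left o) = Reducible-par (communicates-within i o)
communicates-within (right i) (right o) = Reducible-≅ par-comm (Reducible-par (communicates-within i o))
communicates-within (left i) (right o) = communicates i o
communicates-within (right i) (left o) = Reducible-≅ par-comm (communicates i o)
communicates-within (under i) (under o) = Reducible-nu (communicates-within i o)

HasRedex⇒Reducible : ∀ {n} {X : Proc n} → HasRedex X → Reducible X
HasRedex⇒Reducible (local r) = LocalRedex⇒Reducible r
HasRedex⇒Reducible (comm i o) = communicates-within i o
HasRedex⇒Reducible (left h) = Reducible-par (HasRedex⇒Reducible h)
HasRedex⇒Reducible (right h) = Reducible-≅ par-comm (Reducible-par (HasRedex⇒Reducible h))
HasRedex⇒Reducible (under h) = Reducible-nu (HasRedex⇒Reducible h)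

HasRedex-⌊⌋ : ∀ {n} (X : Proc n) → X ⇒ X → HasRedex ⌊ X ⌋ → HasRedex X
HasRedex-⌊⌋ (tick X) () _
HasRedex-⌊⌋ (par X Y) (t-par d d') (left h) = left (HasRedex-⌊⌋ X d h)
HasRedex-⌊⌋ (par X Y) (t-par d d') (right h) = right (HasRedex-⌊⌋ Y d' h)
HasRedex-⌊⌋ (nu X) (t-nu d) (under h) = under (HasRedex-⌊⌋ X d h)
HasRedex-⌊⌋ X d (comm i o) = comm (Active-⌊⌋ X d i) (Active-⌊⌋ X d o)
HasRedex-⌊⌋ X d (local r) = local (LocalRedex-⌊⌋ X d r)

NF-⌊⌋ : ∀ {n} {X : Proc n} → X ⇒ X → NF X → NF ⌊ X ⌋
NF-⌊⌋ {X = X} d nf (_ , r) = nf (HasRedex⇒Reducible (HasRedex-⌊⌋ X d (⟶⇒HasRedex r)))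

TickLast-final : ∀ {n} {P Q : Proc n} → TickLast P Q → NF Q × Q ⇒ Q
TickLast-final (tl-stop _ nf d) = nf , d
TickLast-final (tl-step _ _ _ _ _ tl) = TickLast-final tl

TickLast-⌊⌋ : ∀ {n} {P Q : Proc n} → TickLast P Q → ⌊ P ⌋ ⟶* ⌊ Q ⌋
TickLast-⌊⌋ (tl-stop rs _ _) = ⌊⌋-⟶* rs
TickLast-⌊⌋ (tl-step rs _ _ d _ tl) =
  ⌊⌋-⟶* rs ◅◅ subst (_⟶* _) (sym (⌊⌋-⇒ d)) (TickLast-⌊⌋ tl)

theorem3p6 : ∀ {n : ℕ} (P Q : Proc n) → TickLast P Q →
    NF Q × (Q ⇒ Q) × (⌊ P ⌋ ⟶* ⌊ Q ⌋) × NF ⌊ Q ⌋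
theorem3p6 P Q tl with TickLast-final tl
... | nf , d = nf , d , TickLast-⌊⌋ tl , NF-⌊⌋ d nf
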